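{- Let $a>1$, $b>1$, $c>0$, $r>0$, $s>0$ be integers with $\gcd(ra,sb)=1$, and suppose the equation $(-1)^u r a^x + (-1)^v s b^y = c$ has four solutions $(x_i,y_i,u_i,v_i)$, $i=1,2,3,4$ (nonnegative integers $x_i,y_i$, $u_i,v_i\in\{0,1\}$), with $x_1<x_2<x_3<x_4$. Let $Z=\max(x_4,y_1,y_2,y_3,y_4)$. Then $a^{x_3-x_2}\le Z$ and $s\le Z+1$, and, if $a>b$, then $x_2\,a^{x_3-x_2}\le Z$. -}

module Defs where

open import Data.Nat using (ℕ; _⊔_)
open import Data.Bool using (Bool; true; false)
open import Data.Integer using (ℤ; +_; -_; _+_; _*_)
open import Relation.Binary.PropositionalEquality using (_≡_)

-- (-1)^u * z, where u ∈ {0,1} is encoded as a Bool (false = 0, true = 1)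
signed : Bool → ℤ → ℤ
signed false z = z
signed true  z = - z

record Sol : Set where
  constructor sol
  field
    x : ℕ
    y : ℕ
    u : Bool
    v : Bool
open Sol public

IsSolution : (a b c r s : ℕ) → Sol → Set
IsSolution a b c r s t =
  signed (u t) (+ (r Data.Nat.* a Data.Nat.^ x t))
  + signed (v t) (+ (s Data.Nat.* b Data.Nat.^ y t)) ≡ + c

{-# OPTIONS --safe #-}
module Submission where

-- Write Q = r a^x₂ and d = x₃ − x₂. Subtracting the equations of two solutions with x < x′ gives
-- r aˣ (δ′ a^(x′−x) − δ) = s (ε bʸ − ε′ b^y′); as gcd(ra, sb) = 1, this makes b^|y−y′| ≡ ±1 modulo r aˣ,
-- and s divides δ′ a^(x′−x) − δ, a nonzero number of absolute value at most a^(x′−x) + 1. Solutions 2, 3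
-- thus give s ≤ aᵈ + 1 and bᵉ ≡ ±1 (mod Q) with a cofactor prime to a, and solutions 3, 4 give bⁿ ≡ ±1
-- (mod Q aᵈ) with 0 < n ≤ Z. For f = gcd(e, n) one gets b^f = ±1 + L Q with L prime to a, and lifting the
-- exponent from f to n shows aᵈ ∣ n / f, hence aᵈ ≤ Z. Finally a^x₂ ≤ Q ≤ b^f + 1 forces x₂ ≤ f when
-- a > b, so x₂ aᵈ ≤ f · (n / f) ≤ Z. Solutions 1 and 2 serve only to verify the 2-adic hypothesis of the
-- lifting lemma when a is even.

module ExponentialCongruences where

  open import Data.Nat as ℕ using (ℕ; zero; suc)
  import Data.Nat.Properties as ℕP
  import Data.Nat.Divisibility as ℕD
  import Data.Nat.Coprimality as ℕC
  import Data.Nat.DivMod as ℕM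
  open import Data.Nat.Combinatorics using (_C_; nC1≡n; nCk+nC[k+1]≡[n+1]C[k+1])
  open import Data.Nat.GCD using (gcd; gcd-GCD; gcd[m,n]∣m; gcd[m,n]∣n; module Bézout)
  open import Data.Integer using (ℤ; +_; _+_; _*_; _-_; -_; _^_; ∣_∣; 0ℤ; 1ℤ; -1ℤ; ≢-nonZero)
  open import Data.Integer.Properties
  open import Data.Integer.Divisibility.Signed
    using ( _∣_; divides; 0∣⇒≡0; ∣-refl; ∣-trans; ∣m∣n⇒∣m+n; ∣m∣n⇒∣m-n; ∣m+n∣n⇒∣m; ∣n⇒∣m*n; ∣m⇒∣m*n
          ; ∣⇒∣ᵤ; ∣ᵤ⇒∣; *-monoʳ-∣; *-cancelˡ-∣; *-cancelʳ-∣)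
  import Data.Integer.Coprimality as ℤC
  open import Data.Integer.Tactic.RingSolver using (solve-∀)
  open import Data.Sum using (_⊎_; inj₁; inj₂)
  open import Data.Product using (∃-syntax; _×_; _,_; proj₁; proj₂)
  open import Data.Empty using (⊥-elim)
  open import Relation.Nullary using (¬_)
  open import Relation.Binary.PropositionalEquality
  open import Function using (_∘_)

  private variable
    g x y z M : ℤ

  IsUnit : ℤ → Set
  IsUnit η = η ≡ 1ℤ ⊎ η ≡ -1ℤ

  unit*unit≡1 : ∀ {η} → IsUnit η → η * η ≡ 1ℤ
  unit*unit≡1 (inj₁ refl) = refl
  unit*unit≡1 (inj₂ refl) = refl

  x+y[1-η²]≡x : ∀ {η} → IsUnit η → ∀ x y → x + y * (1ℤ - η * η) ≡ x
  x+y[1-η²]≡x u x y =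
    trans (cong (λ t → x + y * (1ℤ - t)) (unit*unit≡1 u)) (trans (cong (_+_ x) (*-zeroʳ y)) (+-identityʳ x))

  IsUnit-* : ∀ {η μ} → IsUnit η → IsUnit μ → IsUnit (η * μ)
  IsUnit-* (inj₁ refl) (inj₁ refl) = inj₁ refl
  IsUnit-* (inj₁ refl) (inj₂ refl) = inj₂ refl
  IsUnit-* (inj₂ refl) (inj₁ refl) = inj₂ refl
  IsUnit-* (inj₂ refl) (inj₂ refl) = inj₁ refl

  IsUnit-^ : ∀ {η} → IsUnit η → ∀ k → IsUnit (η ^ k)
  IsUnit-^ u zero    = inj₁ refl
  IsUnit-^ u (suc k) = IsUnit-* u (IsUnit-^ u k)

  IsUnit-neg : ∀ {η} → IsUnit η → IsUnit (- η)
  IsUnit-neg (inj₁ refl) = inj₂ refl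
  IsUnit-neg (inj₂ refl) = inj₁ refl

  ∣unit∣≡1 : ∀ {η} → IsUnit η → ∣ η ∣ ≡ 1
  ∣unit∣≡1 (inj₁ refl) = refl
  ∣unit∣≡1 (inj₂ refl) = refl

  ∣x+unit∣≤ : ∀ {η} x → IsUnit η → ∣ x + η ∣ ℕ.≤ ∣ x ∣ ℕ.+ 1
  ∣x+unit∣≤ {η} x u = subst (∣ x + η ∣ ℕ.≤_) (cong (∣ x ∣ ℕ.+_) (∣unit∣≡1 u)) (∣i+j∣≤∣i∣+∣j∣ x η)

  ∣unit⇒∣1 : ∀ {η g} → IsUnit η → g ∣ η → g ∣ 1ℤ
  ∣unit⇒∣1 {η} u g∣η = subst (_ ∣_) (unit*unit≡1 u) (∣n⇒∣m*n η g∣η)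

  ∣*unit⇒∣ : ∀ {η g x} → IsUnit η → g ∣ x * η → g ∣ x
  ∣*unit⇒∣ {η} {g} {x} u g∣xη =
    subst (g ∣_) (trans (*-assoc x η η) (trans (cong (x *_) (unit*unit≡1 u)) (*-identityʳ x))) (∣m⇒∣m*n η g∣xη)

  2∣unit-unit : ∀ {η μ} → IsUnit η → IsUnit μ → + 2 ∣ η - μ
  2∣unit-unit (inj₁ refl) (inj₁ refl) = divides 0ℤ refl
  2∣unit-unit (inj₁ refl) (inj₂ refl) = divides 1ℤ refl
  2∣unit-unit (inj₂ refl) (inj₁ refl) = divides -1ℤ refl
  2∣unit-unit (inj₂ refl) (inj₂ refl) = divides 0ℤ refl

  3≤∣x∣⇒x≢0 : 3 ℕ.≤ ∣ x ∣ → x ≢ 0ℤ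
  3≤∣x∣⇒x≢0 () refl

  unit≡unit-mod : ∀ {M η μ} → 3 ℕ.≤ ∣ M ∣ → IsUnit η → IsUnit μ → M ∣ η - μ → η ≡ μ
  unit≡unit-mod _ (inj₁ refl) (inj₁ refl) _ = refl
  unit≡unit-mod _ (inj₂ refl) (inj₂ refl) _ = refl
  unit≡unit-mod 3≤M (inj₁ refl) (inj₂ refl) M∣2 = ⊥-elim (ℕP.<⇒≱ 3≤M (ℕD.∣⇒≤ (∣⇒∣ᵤ M∣2)))
  unit≡unit-mod 3≤M (inj₂ refl) (inj₁ refl) M∣2 = ⊥-elim (ℕP.<⇒≱ 3≤M (ℕD.∣⇒≤ (∣⇒∣ᵤ M∣2)))

  -- Coprimality

  -- Unlike `Data.Integer.Coprimality.Coprime`, which goes through absolute values, this form lets Agda infer its arguments.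
  Coprime : ℤ → ℤ → Set
  Coprime x y = ∀ {g} → g ∣ x → g ∣ y → g ∣ 1ℤ

  coprime-sym : Coprime x y → Coprime y x
  coprime-sym c p q = c q p

  coprime⇒coprimeᵤ : Coprime x y → ℤC.Coprime x y
  coprime⇒coprimeᵤ c (p , q) = ℕD.∣1⇒≡1 (∣⇒∣ᵤ (c (∣ᵤ⇒∣ {k = + _} p) (∣ᵤ⇒∣ {k = + _} q)))

  coprimeᵤ⇒coprime : ℤC.Coprime x y → Coprime x y
  coprimeᵤ⇒coprime c p q = ∣ᵤ⇒∣ (ℕD.∣-reflexive (c (∣⇒∣ᵤ p , ∣⇒∣ᵤ q)))

  coprime-divisor : Coprime x y → x ∣ y * z → x ∣ z
  coprime-divisor {x} {y} {z} c x∣yz = ∣ᵤ⇒∣ (ℤC.coprime-divisor x y z (coprime⇒coprimeᵤ c) (∣⇒∣ᵤ x∣yz))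

  coprime-∣ˡ : z ∣ x → Coprime x y → Coprime z y
  coprime-∣ˡ z∣x c p q = c (∣-trans p z∣x) q

  coprime-∣ʳ : z ∣ y → Coprime x y → Coprime x z
  coprime-∣ʳ z∣y c p q = c p (∣-trans q z∣y)

  coprime-*ˡ : Coprime x z → Coprime y z → Coprime (x * y) z
  coprime-*ˡ cx cy g∣xy g∣z = cy (coprime-divisor (λ h∣g h∣x → cx h∣x (∣-trans h∣g g∣z)) g∣xy) g∣z

  coprime-^ˡ : Coprime x z → ∀ k → Coprime (x ^ k) z
  coprime-^ˡ c zero    p _ = p
  coprime-^ˡ c (suc k) = coprime-*ˡ c (coprime-^ˡ c k)

  ¬coprime-0 : ∀ {a} → 1 ℕ.< a → ¬ Coprime 0ℤ (+ a)
  ¬coprime-0 1<a c = ℕC.¬0-coprimeTo-2+ {{ℕ.n>1⇒nonTrivial 1<a}} (coprime⇒coprimeᵤ c)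

  coprime-unit*aᵏ-unit : ∀ {δ δ′ A} k → 1 ℕ.≤ k → IsUnit δ → IsUnit δ′ → Coprime (δ * A ^ k - δ′) A
  coprime-unit*aᵏ-unit {δ} {δ′} {A} (suc k) _ δ-unit δ′-unit g∣K g∣A =
    ∣unit⇒∣1 δ′-unit (subst (_ ∣_) (cancel δ (A ^ suc k) δ′)
      (∣m∣n⇒∣m-n (∣n⇒∣m*n δ (∣m⇒∣m*n (A ^ k) g∣A)) g∣K))
    where
    cancel : ∀ x y z → x * y - (x * y - z) ≡ z
    cancel = solve-∀

  -- Powers

  pos-^ : ∀ a k → (+ a) ^ k ≡ + (a ℕ.^ k)
  pos-^ a zero    = refl
  pos-^ a (suc k) = trans (cong (+ a *_) (pos-^ a k)) (sym (pos-* a (a ℕ.^ k)))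

  ^-split : ∀ x {m n} → m ℕ.≤ n → x ^ n ≡ x ^ m * x ^ (n ℕ.∸ m)
  ^-split x {m} {n} m≤n = trans (cong (x ^_) (sym (ℕP.m+[n∸m]≡n m≤n))) (^-distribˡ-+-* x m (n ℕ.∸ m))

  xᵐ∣xⁿ : ∀ x {m n} → m ℕ.≤ n → x ^ m ∣ x ^ n
  xᵐ∣xⁿ x {m} {n} m≤n = divides (x ^ (n ℕ.∸ m)) (trans (^-split x m≤n) (*-comm (x ^ m) _))

  x-y∣xᵏ-yᵏ : ∀ x y k → (x - y) ∣ (x ^ k - y ^ k)
  x-y∣xᵏ-yᵏ x y zero    = divides 0ℤ refl
  x-y∣xᵏ-yᵏ x y (suc k) =
    subst (_ ∣_) (split x y (x ^ k) (y ^ k))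
      (∣m∣n⇒∣m+n (∣n⇒∣m*n x (x-y∣xᵏ-yᵏ x y k)) (∣n⇒∣m*n (y ^ k) ∣-refl))
    where
    split : ∀ x y xᵏ yᵏ → x * (xᵏ - yᵏ) + yᵏ * (x - y) ≡ x * xᵏ - y * yᵏ
    split = solve-∀

  ∣unit*aᵏ-unit∣≤ : ∀ a k {δ δ′} → IsUnit δ → IsUnit δ′ → ∣ δ * (+ a) ^ k - δ′ ∣ ℕ.≤ a ℕ.^ k ℕ.+ 1
  ∣unit*aᵏ-unit∣≤ a k {δ} {δ′} δ-unit δ′-unit =
    subst (λ t → ∣ δ * (+ a) ^ k - δ′ ∣ ℕ.≤ t ℕ.+ 1) ∣δaᵏ∣≡aᵏ
          (∣x+unit∣≤ (δ * (+ a) ^ k) (IsUnit-neg δ′-unit))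
    where
    ∣δaᵏ∣≡aᵏ : ∣ δ * (+ a) ^ k ∣ ≡ a ℕ.^ k
    ∣δaᵏ∣≡aᵏ = trans (abs-* δ ((+ a) ^ k))
                     (trans (cong₂ ℕ._*_ (∣unit∣≡1 δ-unit) (cong ∣_∣ (pos-^ a k))) (ℕP.*-identityˡ _))

  record PowerDifference (B D : ℤ) (bound : ℕ) : Set where
    field
      k m : ℕ
      η σ : ℤ
      η-unit : IsUnit η
      σ-unit : IsUnit σ
      k≤bound : k ℕ.≤ bound
      D≡σBᵐ[Bᵏ-η] : D ≡ σ * (B ^ m * (B ^ k - η))

  power-difference-≤ : ∀ B {ε ε′} y y′ → y ℕ.≤ y′ → IsUnit ε → IsUnit ε′ →
    PowerDifference B (ε * B ^ y - ε′ * B ^ y′) y′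
  power-difference-≤ B {ε} {ε′} y y′ y≤y′ ε-unit ε′-unit = record
    { k = y′ ℕ.∸ y ; m = y ; η = ε′ * ε ; σ = - ε′
    ; η-unit = IsUnit-* ε′-unit ε-unit ; σ-unit = IsUnit-neg ε′-unit
    ; k≤bound = ℕP.m∸n≤m y′ y
    ; D≡σBᵐ[Bᵏ-η] = begin
        ε * B ^ y - ε′ * B ^ y′
          ≡⟨ cong (λ t → ε * B ^ y - ε′ * t) (^-split B y≤y′) ⟩
        ε * B ^ y - ε′ * (B ^ y * B ^ (y′ ℕ.∸ y))
          ≡⟨ factor ε ε′ (B ^ y) (B ^ (y′ ℕ.∸ y)) ⟩
        - ε′ * (B ^ y * (B ^ (y′ ℕ.∸ y) - ε′ * ε)) + ε * B ^ y * (1ℤ - ε′ * ε′)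
          ≡⟨ x+y[1-η²]≡x ε′-unit _ (ε * B ^ y) ⟩
        - ε′ * (B ^ y * (B ^ (y′ ℕ.∸ y) - ε′ * ε)) ∎
    }
    where
    open ≡-Reasoning
    factor : ∀ ε ε′ Bʸ Bᵏ →
      ε * Bʸ - ε′ * (Bʸ * Bᵏ) ≡ - ε′ * (Bʸ * (Bᵏ - ε′ * ε)) + ε * Bʸ * (1ℤ - ε′ * ε′)
    factor = solve-∀

  power-difference : ∀ B {ε ε′} y y′ → IsUnit ε → IsUnit ε′ →
    PowerDifference B (ε * B ^ y - ε′ * B ^ y′) (y ℕ.⊔ y′)
  power-difference B {ε} {ε′} y y′ ε-unit ε′-unit with ℕP.≤-total y y′
  ... | inj₁ y≤y′ = weaken (ℕP.m≤n⊔m y y′) (power-difference-≤ B y y′ y≤y′ ε-unit ε′-unit)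
    where
    weaken : ∀ {D b b′} → b ℕ.≤ b′ → PowerDifference B D b → PowerDifference B D b′
    weaken b≤b′ p = record
      { k = k ; m = m ; η = η ; σ = σ ; η-unit = η-unit ; σ-unit = σ-unit
      ; k≤bound = ℕP.≤-trans k≤bound b≤b′ ; D≡σBᵐ[Bᵏ-η] = D≡σBᵐ[Bᵏ-η] }
      where open PowerDifference p
  ... | inj₂ y′≤y = swap (power-difference-≤ B y′ y y′≤y ε′-unit ε-unit)
    where
    flip : ∀ {x y z} → y - x ≡ z → x - y ≡ - z
    flip {x} {y} refl = negate x y
      where
      negate : ∀ x y → x - y ≡ - (y - x)
      negate = solve-∀
    swap : PowerDifference B (ε′ * B ^ y′ - ε * B ^ y) y → PowerDifference B (ε * B ^ y - ε′ * B ^ y′) (y ℕ.⊔ y′)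
    swap p = record
      { k = k ; m = m ; η = η ; σ = - σ ; η-unit = η-unit ; σ-unit = IsUnit-neg σ-unit
      ; k≤bound = ℕP.≤-trans k≤bound (ℕP.m≤m⊔n y y′)
      ; D≡σBᵐ[Bᵏ-η] =
          trans (flip {ε * B ^ y} {ε′ * B ^ y′} D≡σBᵐ[Bᵏ-η]) (neg-distribˡ-* σ (B ^ m * (B ^ k - η)))
      }
      where open PowerDifference p

  -- Lifting the exponent

  C2-suc : ∀ j → suc j C 2 ≡ j C 2 ℕ.+ j
  C2-suc j = trans (sym (nCk+nC[k+1]≡[n+1]C[k+1] j 1)) (trans (cong (ℕ._+ j C 2) (nC1≡n j)) (ℕP.+-comm j (j C 2)))

  2*C2 : ∀ n → + 2 * + (n C 2) ≡ + n * (+ n - 1ℤ)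
  2*C2 zero    = refl
  2*C2 (suc n) = begin
    + 2 * + (suc n C 2)          ≡⟨ cong (λ t → + 2 * + t) (C2-suc n) ⟩
    + 2 * (+ (n C 2) + + n)      ≡⟨ *-distribˡ-+ (+ 2) (+ (n C 2)) (+ n) ⟩
    + 2 * + (n C 2) + + 2 * + n  ≡⟨ cong (_+ + 2 * + n) (2*C2 n) ⟩
    + n * (+ n - 1ℤ) + + 2 * + n ≡⟨ step (+ n) ⟩
    + suc n * (+ suc n - 1ℤ)     ∎
    where
    open ≡-Reasoning
    step : ∀ m → m * (m - 1ℤ) + + 2 * m ≡ (1ℤ + m) * ((1ℤ + m) - 1ℤ)
    step = solve-∀

  2∣odd-1 : ∀ {n} → ¬ 2 ℕD.∣ n → + 2 ∣ + n - 1ℤ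
  2∣odd-1 {n} n-odd with n ℕM.% 2 | ℕM.m%n<n n 2 | ℕM.m≡m%n+[m/n]*n n 2
  ... | 0           | _                 | n≡[n/2]*2   = ⊥-elim (n-odd (ℕD.divides (n ℕM./ 2) n≡[n/2]*2))
  ... | 1           | _                 | n≡1+[n/2]*2 = divides (+ (n ℕM./ 2)) (begin
    + n - 1ℤ                           ≡⟨ cong (λ m → + m - 1ℤ) n≡1+[n/2]*2 ⟩
    1ℤ + + (n ℕM./ 2 ℕ.* 2) - 1ℤ      ≡⟨ cong (λ t → 1ℤ + t - 1ℤ) (pos-* (n ℕM./ 2) 2) ⟩
    1ℤ + + (n ℕM./ 2) * + 2 - 1ℤ      ≡⟨ cancel (+ (n ℕM./ 2) * + 2) ⟩
    + (n ℕM./ 2) * + 2                 ∎)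
    where
    open ≡-Reasoning
    cancel : ∀ x → 1ℤ + x - 1ℤ ≡ x
    cancel = solve-∀
  ... | suc (suc _) | ℕ.s≤s (ℕ.s≤s ()) | _

  a²∣[aC2]*Q-odd : ∀ a {Q} → ¬ 2 ℕD.∣ a → + a ∣ Q → (+ a * + a) ∣ + (a C 2) * Q
  a²∣[aC2]*Q-odd a a-odd (divides q refl) with 2∣odd-1 a-odd
  ... | divides h a-1≡h*2 = divides (h * q) (begin
    + (a C 2) * (q * A)     ≡⟨ cong (_* (q * A)) aC2≡a*h ⟩
    A * h * (q * A)         ≡⟨ rearrange A h q ⟩
    h * q * (A * A)         ∎)
    where
    open ≡-Reasoning
    A = + a
    double : ∀ A h → A * (h * + 2) ≡ + 2 * (A * h)
    double = solve-∀
    rearrange : ∀ A h q → A * h * (q * A) ≡ h * q * (A * A)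
    rearrange = solve-∀
    aC2≡a*h : + (a C 2) ≡ A * h
    aC2≡a*h = *-cancelˡ-≡ (+ 2) (+ (a C 2)) (A * h) (trans (2*C2 a) (trans (cong (A *_) a-1≡h*2) (double A h)))

  a²∣[aC2]*Q-even : ∀ a {Q} → (+ 2 * + a) ∣ Q → (+ a * + a) ∣ + (a C 2) * Q
  a²∣[aC2]*Q-even a (divides q refl) = divides ((A - 1ℤ) * q) (begin
    + (a C 2) * (q * (+ 2 * A))     ≡⟨ regroup (+ (a C 2)) q A ⟩
    + 2 * + (a C 2) * q * A         ≡⟨ cong (λ t → t * q * A) (2*C2 a) ⟩
    A * (A - 1ℤ) * q * A            ≡⟨ rearrange A q ⟩
    (A - 1ℤ) * q * (A * A)          ∎)
    where
    open ≡-Reasoning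
    A = + a
    regroup : ∀ t q A → t * (q * (+ 2 * A)) ≡ + 2 * t * q * A
    regroup = solve-∀
    rearrange : ∀ A q → A * (A - 1ℤ) * q * A ≡ (A - 1ℤ) * q * (A * A)
    rearrange = solve-∀

  -- The binomial expansion of (η + T)ʲ up to T², written with ηʲ⁻¹ = ηʲ η and ηʲ⁻² = ηʲ since η² = 1.
  second-order : ℤ → ℤ → ℕ → ℤ
  second-order η T j = η ^ j * (1ℤ + + j * η * T + + (j C 2) * T * T)

  second-order-suc : ∀ {η} → IsUnit η → ∀ T j →
    (η + T) * second-order η T j - second-order η T (suc j) ≡ (+ (j C 2) * η ^ j) * (T * T * T)
  second-order-suc {η} u T j = begin
    (η + T) * E j - η * η ^ j * (1ℤ + + suc j * η * T + + (suc j C 2) * T * T)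
      ≡⟨ cong (λ t → (η + T) * E j - η * η ^ j * (1ℤ + + suc j * η * T + + t * T * T)) (C2-suc j) ⟩
    (η + T) * E j - η * η ^ j * (1ℤ + (1ℤ + + j) * η * T + (+ (j C 2) + + j) * T * T)
      ≡⟨ expand η T (η ^ j) (+ j) (+ (j C 2)) ⟩
    (+ (j C 2) * η ^ j) * (T * T * T) + η ^ j * T * (1ℤ - η * η)
      ≡⟨ x+y[1-η²]≡x u _ (η ^ j * T) ⟩
    (+ (j C 2) * η ^ j) * (T * T * T) ∎
    where
    open ≡-Reasoning
    E = second-order η T
    expand : ∀ η T P J t →
      (η + T) * (P * (1ℤ + J * η * T + t * T * T)) - η * P * (1ℤ + (1ℤ + J) * η * T + (t + J) * T * T)
        ≡ (t * P) * (T * T * T) + P * T * (1ℤ - η * η)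
    expand = solve-∀

  binomial-mod-T³ : ∀ {η} → IsUnit η → ∀ T j → (T * T * T) ∣ ((η + T) ^ j - second-order η T j)
  binomial-mod-T³ {η} u T zero = divides 0ℤ (constant η T)
    where
    constant : ∀ η T → 1ℤ - 1ℤ * (1ℤ + 0ℤ * η * T + 0ℤ * T * T) ≡ 0ℤ * (T * T * T)
    constant = solve-∀
  binomial-mod-T³ {η} u T (suc j) =
    subst (_ ∣_) (split (η + T) ((η + T) ^ j) (second-order η T j) (second-order η T (suc j)))
      (∣m∣n⇒∣m+n (∣n⇒∣m*n (η + T) (binomial-mod-T³ u T j))
                 (divides (+ (j C 2) * η ^ j) (second-order-suc u T j)))
    where
    split : ∀ x p e e′ → x * (p - e) + (x * e - e′) ≡ x * p - e′
    split = solve-∀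

  -- For odd a the last hypothesis follows from a ∣ T; for even a it says 2a ∣ T, the usual 2-adic
  -- hypothesis of lifting the exponent.
  lift-by-a : ∀ a {η T} → IsUnit η → + a ∣ T → (+ a * + a) ∣ + (a C 2) * T →
    ∃[ v ] (η + T) ^ a - η ^ a ≡ v * (T * + a) × Coprime v (+ a)
  lift-by-a a {η} u (divides τ refl) (divides w [aC2]T≡w*a²) with binomial-mod-T³ u (τ * + a) a
  ... | divides X remainder = v , expansion , v⊥a
    where
    open ≡-Reasoning
    A = + a
    T = τ * A
    P = η ^ a
    v = P * η + P * w * A + X * τ * τ * A
    split : ∀ Y P η A T t → Y - P ≡ (Y - P * (1ℤ + A * η * T + t * T * T)) + P * η * A * T + P * T * (t * T)
    split = solve-∀
    collect : ∀ X P η τ A w →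
      X * (τ * A * (τ * A) * (τ * A)) + P * η * A * (τ * A) + P * (τ * A) * (w * (A * A))
        ≡ (P * η + P * w * A + X * τ * τ * A) * (τ * A * A)
    collect = solve-∀
    expansion : (η + T) ^ a - P ≡ v * (T * A)
    expansion = begin
      (η + T) ^ a - P
        ≡⟨ split ((η + T) ^ a) P η A T (+ (a C 2)) ⟩
      ((η + T) ^ a - second-order η T a) + P * η * A * T + P * T * (+ (a C 2) * T)
        ≡⟨ cong₂ (λ p q → p + P * η * A * T + P * T * q) remainder [aC2]T≡w*a² ⟩
      X * (T * T * T) + P * η * A * T + P * T * (w * (A * A))
        ≡⟨ collect X P η τ A w ⟩
      v * (T * A) ∎
    residue : ∀ P η w A X τ → (P * η + P * w * A + X * τ * τ * A) - A * (P * w + X * τ * τ) ≡ P * η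
    residue = solve-∀
    v⊥a : Coprime v A
    v⊥a g∣v g∣A = ∣unit⇒∣1 (IsUnit-* (IsUnit-^ u a) u)
      (subst (_ ∣_) (residue P η w A X τ) (∣m∣n⇒∣m-n g∣v (∣m⇒∣m*n (P * w + X * τ * τ) g∣A)))

  first-order-expansion : ∀ {η} → IsUnit η → ∀ T N →
    ∃[ W ] (η + T) ^ N - η ^ N ≡ T * (+ N * (η ^ N * η) + T * W)
  first-order-expansion {η} u T N with binomial-mod-T³ u T N
  ... | divides X remainder = η ^ N * + (N C 2) + X * T , (begin
    (η + T) ^ N - η ^ N
      ≡⟨ split ((η + T) ^ N) (η ^ N) η (+ N) (+ (N C 2)) T ⟩
    ((η + T) ^ N - second-order η T N) + T * (+ N * (η ^ N * η) + T * (η ^ N * + (N C 2)))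
      ≡⟨ cong (_+ T * (+ N * (η ^ N * η) + T * (η ^ N * + (N C 2)))) remainder ⟩
    X * (T * T * T) + T * (+ N * (η ^ N * η) + T * (η ^ N * + (N C 2)))
      ≡⟨ collect X T (+ N * (η ^ N * η)) (η ^ N * + (N C 2)) ⟩
    T * (+ N * (η ^ N * η) + T * (η ^ N * + (N C 2) + X * T)) ∎)
    where
    open ≡-Reasoning
    split : ∀ Y P η J t T → Y - P ≡ (Y - P * (1ℤ + J * η * T + t * T * T)) + T * (J * (P * η) + T * (P * t))
    split = solve-∀
    collect : ∀ X T V W → X * (T * T * T) + T * (V + T * W) ≡ T * (V + T * (W + X * T))
    collect = solve-∀

  a∣exponent : ∀ a {η Q L} N → IsUnit η → Q ≢ 0ℤ → + a ∣ Q → Coprime L (+ a) →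
    (Q * + a) ∣ ((η + Q * L) ^ N - η ^ N) → + a ∣ + N
  a∣exponent a {η} {Q} {L} N u Q≢0 a∣Q L⊥a h with first-order-expansion u (Q * L) N
  ... | W , eq = ∣*unit⇒∣ (IsUnit-* (IsUnit-^ u N) u) a∣Nηᴺ⁺¹
    where
    instance _ = ≢-nonZero Q≢0
    V = + N * (η ^ N * η) + Q * L * W
    a∣V : + a ∣ V
    a∣V = coprime-divisor (coprime-sym L⊥a) (*-cancelˡ-∣ Q (subst (_ ∣_) (trans eq (*-assoc Q L V)) h))
    a∣Nηᴺ⁺¹ : + a ∣ + N * (η ^ N * η)
    a∣Nηᴺ⁺¹ = ∣m+n∣n⇒∣m a∣V (∣m⇒∣m*n W (∣m⇒∣m*n L a∣Q))

  lifting-the-exponent : ∀ a m {η Q L N} → IsUnit η → Q ≢ 0ℤ → + a ∣ Q → (+ a * + a) ∣ + (a C 2) * Q →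
    Coprime L (+ a) → (Q * (+ a) ^ m) ∣ ((η + Q * L) ^ N - η ^ N) → (+ a) ^ m ∣ + N
  lifting-the-exponent a zero {N = N} _ _ _ _ _ _ = divides (+ N) (sym (*-identityʳ (+ N)))
  lifting-the-exponent a (suc m) {η} {Q} {L} {N} u Q≢0 a∣Q a²∣[aC2]Q L⊥a h =
    subst ((+ a) ^ suc m ∣_) A*N′≡N (*-monoʳ-∣ A ih)
    where
    open ≡-Reasoning
    A = + a
    a²∣[aC2]Q* : ∀ x → (A * A) ∣ + (a C 2) * (Q * x)
    a²∣[aC2]Q* x = subst (_ ∣_) (*-assoc (+ (a C 2)) Q x) (∣m⇒∣m*n x a²∣[aC2]Q)
    Qa∣Qaᵐ⁺¹ : (Q * A) ∣ (Q * A ^ suc m)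
    Qa∣Qaᵐ⁺¹ = subst ((Q * A) ∣_) (*-assoc Q A (A ^ m)) (∣m⇒∣m*n (A ^ m) ∣-refl)
    open ℕD._∣_ (∣⇒∣ᵤ (a∣exponent a N u Q≢0 a∣Q L⊥a (∣-trans Qa∣Qaᵐ⁺¹ h)))
      renaming (quotient to N′; equality to N≡N′*a)
    a*N′≡N : a ℕ.* N′ ≡ N
    a*N′≡N = trans (ℕP.*-comm a N′) (sym N≡N′*a)
    A*N′≡N : A * + N′ ≡ + N
    A*N′≡N = trans (sym (pos-* a N′)) (cong +_ a*N′≡N)
    lifted = lift-by-a a u (∣m⇒∣m*n L a∣Q) (a²∣[aC2]Q* L)
    v = proj₁ lifted
    Q′ = Q * A
    L′ = L * v
    base : (η + Q * L) ^ a ≡ η ^ a + Q′ * L′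
    base = begin
      (η + Q * L) ^ a                       ≡⟨ x≡y+[x-y] ((η + Q * L) ^ a) (η ^ a) ⟩
      η ^ a + ((η + Q * L) ^ a - η ^ a)     ≡⟨ cong (_+_ (η ^ a)) (proj₁ (proj₂ lifted)) ⟩
      η ^ a + v * (Q * L * A)               ≡⟨ cong (_+_ (η ^ a)) (rearrange v Q L A) ⟩
      η ^ a + Q′ * L′                       ∎
      where
      x≡y+[x-y] : ∀ x y → x ≡ y + (x - y)
      x≡y+[x-y] = solve-∀
      rearrange : ∀ v Q L A → v * (Q * L * A) ≡ Q * A * (L * v)
      rearrange = solve-∀
    ^N′ : ∀ x → (x ^ a) ^ N′ ≡ x ^ N
    ^N′ x = trans (^-*-assoc x a N′) (cong (x ^_) a*N′≡N)
    Q′≢0 : Q′ ≢ 0ℤ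
    Q′≢0 Q′≡0 with i*j≡0⇒i≡0∨j≡0 Q Q′≡0
    ... | inj₁ Q≡0 = Q≢0 Q≡0
    ... | inj₂ A≡0 = Q≢0 (0∣⇒≡0 (subst (_∣ Q) A≡0 a∣Q))
    h′ : (Q′ * A ^ m) ∣ ((η ^ a + Q′ * L′) ^ N′ - (η ^ a) ^ N′)
    h′ = subst₂ _∣_ (sym (*-assoc Q A (A ^ m)))
                    (sym (cong₂ _-_ (trans (cong (_^ N′) (sym base)) (^N′ (η + Q * L))) (^N′ η))) h
    ih : A ^ m ∣ + N′
    ih = lifting-the-exponent a m (IsUnit-^ u a) Q′≢0 (∣n⇒∣m*n Q ∣-refl) (a²∣[aC2]Q* A)
                              (coprime-*ˡ L⊥a (proj₂ (proj₂ lifted))) h′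

  -- Powers congruent to ±1

  UnitPower : ℤ → ℤ → ℕ → Set
  UnitPower M B k = ∃[ η ] IsUnit η × M ∣ B ^ k - η

  unitPower-0 : ∀ M B → UnitPower M B 0
  unitPower-0 M B = 1ℤ , inj₁ refl , divides 0ℤ refl

  unitPower-+ : ∀ {M B} j k → UnitPower M B j → UnitPower M B k → UnitPower M B (j ℕ.+ k)
  unitPower-+ {M} {B} j k (η , η-unit , M∣j) (μ , μ-unit , M∣k) =
    η * μ , IsUnit-* η-unit μ-unit ,
    subst (M ∣_) (sym (trans (cong (_- η * μ) (^-distribˡ-+-* B j k)) (split (B ^ j) (B ^ k) η μ)))
      (∣m∣n⇒∣m+n (∣n⇒∣m*n (B ^ j) M∣k) (∣n⇒∣m*n μ M∣j))
    where
    split : ∀ Bʲ Bᵏ η μ → Bʲ * Bᵏ - η * μ ≡ Bʲ * (Bᵏ - μ) + μ * (Bʲ - η)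
    split = solve-∀

  unitPower-* : ∀ {M B} c j → UnitPower M B j → UnitPower M B (c ℕ.* j)
  unitPower-* {M} {B} zero    j p = unitPower-0 M B
  unitPower-* {M} {B} (suc c) j p = unitPower-+ j (c ℕ.* j) p (unitPower-* c j p)

  unitPower-∸ : ∀ {M B} d e → UnitPower M B (d ℕ.+ e) → UnitPower M B e → UnitPower M B d
  unitPower-∸ {M} {B} d e (μ , μ-unit , M∣d+e) (η , η-unit , M∣e) =
    η * μ , IsUnit-* η-unit μ-unit ,
    subst (M ∣_) (sym (begin
      B ^ d - η * μ
        ≡⟨ split (B ^ d) (B ^ e) η μ ⟩
      η * ((B ^ d * B ^ e - μ) - B ^ d * (B ^ e - η)) + B ^ d * (1ℤ - η * η)
        ≡⟨ x+y[1-η²]≡x η-unit _ (B ^ d) ⟩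
      η * ((B ^ d * B ^ e - μ) - B ^ d * (B ^ e - η)) ∎))
      (∣n⇒∣m*n η (∣m∣n⇒∣m-n (subst (λ t → M ∣ t - μ) (^-distribˡ-+-* B d e) M∣d+e)
                            (∣n⇒∣m*n (B ^ d) M∣e)))
    where
    open ≡-Reasoning
    split : ∀ Bᵈ Bᵉ η μ → Bᵈ - η * μ ≡ η * ((Bᵈ * Bᵉ - μ) - Bᵈ * (Bᵉ - η)) + Bᵈ * (1ℤ - η * η)
    split = solve-∀

  unitPower-gcd : ∀ {M B} j k → UnitPower M B j → UnitPower M B k → UnitPower M B (gcd j k)
  unitPower-gcd {M} {B} j k pj pk with Bézout.identity (gcd-GCD j k)
  ... | Bézout.+- x y eq =
    unitPower-∸ (gcd j k) (y ℕ.* k) (subst (UnitPower M B) (sym eq) (unitPower-* x j pj)) (unitPower-* y k pk)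
  ... | Bézout.-+ x y eq =
    unitPower-∸ (gcd j k) (x ℕ.* j) (subst (UnitPower M B) (sym eq) (unitPower-* y k pk)) (unitPower-* x j pj)

  power-of-congruence : ∀ {Q η μ B L L′} f j → 3 ℕ.≤ ∣ Q ∣ → IsUnit η → IsUnit μ →
    B ^ f - η ≡ L * Q → B ^ (j ℕ.* f) - μ ≡ L′ * Q → μ ≡ η ^ j × L ∣ L′
  power-of-congruence {Q} {η} {μ} {B} {L} {L′} f j 3≤∣Q∣ η-unit μ-unit Bᶠ-η≡LQ Bʲᶠ-μ≡L′Q = μ≡ηʲ , L∣L′
    where
    instance _ = ≢-nonZero (3≤∣x∣⇒x≢0 {Q} 3≤∣Q∣)
    Bᶠʲ≡Bʲᶠ : (B ^ f) ^ j ≡ B ^ (j ℕ.* f)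
    Bᶠʲ≡Bʲᶠ = trans (^-*-assoc B f j) (cong (B ^_) (ℕP.*-comm f j))
    LQ∣Bʲᶠ-ηʲ : L * Q ∣ B ^ (j ℕ.* f) - η ^ j
    LQ∣Bʲᶠ-ηʲ = subst₂ (λ d t → d ∣ t - η ^ j) Bᶠ-η≡LQ Bᶠʲ≡Bʲᶠ (x-y∣xᵏ-yᵏ (B ^ f) η j)
    difference : ∀ X η μ → (X - μ) - (X - η) ≡ η - μ
    difference = solve-∀
    μ≡ηʲ : μ ≡ η ^ j
    μ≡ηʲ = sym (unit≡unit-mod 3≤∣Q∣ (IsUnit-^ η-unit j) μ-unit
      (subst (Q ∣_) (difference (B ^ (j ℕ.* f)) (η ^ j) μ)
        (∣m∣n⇒∣m-n (divides L′ Bʲᶠ-μ≡L′Q) (∣-trans (∣n⇒∣m*n L ∣-refl) LQ∣Bʲᶠ-ηʲ))))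
    L∣L′ : L ∣ L′
    L∣L′ = *-cancelʳ-∣ Q
      (subst (L * Q ∣_) (trans (cong (λ t → B ^ (j ℕ.* f) - t) (sym μ≡ηʲ)) Bʲᶠ-μ≡L′Q) LQ∣Bʲᶠ-ηʲ)

  ∣Q∣≤bᶠ+1 : ∀ b f {Q L η} → L ≢ 0ℤ → IsUnit η → (+ b) ^ f - η ≡ L * Q → ∣ Q ∣ ℕ.≤ b ℕ.^ f ℕ.+ 1
  ∣Q∣≤bᶠ+1 b f {Q} {L} {η} L≢0 η-unit bᶠ-η≡LQ = begin
    ∣ Q ∣                    ≤⟨ ℕP.m≤n*m ∣ Q ∣ ∣ L ∣ {{ℕ.≢-nonZero (L≢0 ∘ ∣i∣≡0⇒i≡0)}} ⟩
    ∣ L ∣ ℕ.* ∣ Q ∣          ≡⟨ sym (trans (cong ∣_∣ bᶠ-η≡LQ) (abs-* L Q)) ⟩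
    ∣ (+ b) ^ f - η ∣        ≤⟨ ∣x+unit∣≤ ((+ b) ^ f) (IsUnit-neg η-unit) ⟩
    ∣ (+ b) ^ f ∣ ℕ.+ 1      ≡⟨ cong (λ t → ∣ t ∣ ℕ.+ 1) (pos-^ b f) ⟩
    b ℕ.^ f ℕ.+ 1            ∎
    where open ℕP.≤-Reasoning

  record LiftingHypotheses (a : ℕ) (Q : ℤ) : Set where
    field
      3≤∣Q∣ : 3 ℕ.≤ ∣ Q ∣
      a∣Q : + a ∣ Q
      a²∣[aC2]Q : (+ a * + a) ∣ + (a C 2) * Q

  record GcdLift (a : ℕ) (Q B : ℤ) (d n : ℕ) : Set where
    field
      f N : ℕ
      n≡N*f : n ≡ N ℕ.* f
      aᵈ∣N : (+ a) ^ d ∣ + N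
      η L : ℤ
      η-unit : IsUnit η
      L⊥a : Coprime L (+ a)
      Bᶠ-η≡LQ : B ^ f - η ≡ L * Q

  -- Bᵉ ≡ ±1 (mod Q) and Bⁿ ≡ ±1 (mod Q aᵈ) give B^gcd(e,n) = ±1 + L Q with L prime to a, because L divides
  -- the cofactor of Bᵉ ∓ 1; lifting the exponent from gcd(e,n) to n then yields aᵈ ∣ n / gcd(e,n).
  gcd-lift : ∀ a d {Q B e n ηₑ ηₙ Lₑ Lₙ} → LiftingHypotheses a Q →
    IsUnit ηₑ → B ^ e - ηₑ ≡ Lₑ * Q → Coprime Lₑ (+ a) →
    IsUnit ηₙ → B ^ n - ηₙ ≡ Lₙ * (Q * (+ a) ^ d) → GcdLift a Q B d n
  gcd-lift a d {Q} {B} {e} {n} {ηₑ} {ηₙ} {Lₑ} {Lₙ} hyp ηₑ-unit Bᵉ-ηₑ≡LₑQ Lₑ⊥a ηₙ-unit Bⁿ-ηₙ≡LₙQaᵈ =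
    lift (unitPower-gcd e n (ηₑ , ηₑ-unit , divides Lₑ Bᵉ-ηₑ≡LₑQ)
                           (ηₙ , ηₙ-unit , ∣-trans (∣m⇒∣m*n ((+ a) ^ d) ∣-refl) (divides Lₙ Bⁿ-ηₙ≡LₙQaᵈ)))
    where
    open LiftingHypotheses hyp
    Q≢0 = 3≤∣x∣⇒x≢0 3≤∣Q∣
    f = gcd e n
    open ℕD._∣_ (gcd[m,n]∣m e n) renaming (quotient to e′; equality to e≡e′*f)
    open ℕD._∣_ (gcd[m,n]∣n e n) renaming (quotient to N; equality to n≡N*f)
    lift : UnitPower Q B f → GcdLift a Q B d n
    lift (η , η-unit , divides L Bᶠ-η≡LQ) = record
      { f = f ; N = N ; n≡N*f = n≡N*f ; aᵈ∣N = lifting-the-exponent a d η-unit Q≢0 a∣Q a²∣[aC2]Q L⊥a Qaᵈ∣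
      ; η = η ; L = L ; η-unit = η-unit ; L⊥a = L⊥a ; Bᶠ-η≡LQ = Bᶠ-η≡LQ }
      where
      L⊥a : Coprime L (+ a)
      L⊥a = coprime-∣ˡ (proj₂ (power-of-congruence {L = L} {L′ = Lₑ} f e′ 3≤∣Q∣ η-unit ηₑ-unit Bᶠ-η≡LQ
                                  (subst (λ k → B ^ k - ηₑ ≡ Lₑ * Q) e≡e′*f Bᵉ-ηₑ≡LₑQ))) Lₑ⊥a
      reassociate : ∀ L Q D → L * (Q * D) ≡ L * D * Q
      reassociate = solve-∀
      ηₙ≡ηᴺ : ηₙ ≡ η ^ N
      ηₙ≡ηᴺ = proj₁ (power-of-congruence {L = L} {L′ = Lₙ * (+ a) ^ d} f N 3≤∣Q∣ η-unit ηₙ-unit Bᶠ-η≡LQ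
                       (subst (λ k → B ^ k - ηₙ ≡ Lₙ * ((+ a) ^ d) * Q) n≡N*f
                              (trans Bⁿ-ηₙ≡LₙQaᵈ (reassociate Lₙ Q ((+ a) ^ d)))))
      Bᶠ≡η+QL : B ^ f ≡ η + Q * L
      Bᶠ≡η+QL = trans (x≡y+[x-y] (B ^ f) η) (trans (cong (_+_ η) Bᶠ-η≡LQ) (cong (_+_ η) (*-comm L Q)))
        where
        x≡y+[x-y] : ∀ x y → x ≡ y + (x - y)
        x≡y+[x-y] = solve-∀
      Bⁿ≡[η+QL]ᴺ : B ^ n ≡ (η + Q * L) ^ N
      Bⁿ≡[η+QL]ᴺ = trans (cong (B ^_) (trans n≡N*f (ℕP.*-comm N f)))
                         (trans (sym (^-*-assoc B f N)) (cong (_^ N) Bᶠ≡η+QL))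
      Qaᵈ∣ : (Q * (+ a) ^ d) ∣ ((η + Q * L) ^ N - η ^ N)
      Qaᵈ∣ = subst₂ (λ p q → (Q * (+ a) ^ d) ∣ p - q) Bⁿ≡[η+QL]ᴺ ηₙ≡ηᴺ (divides Lₙ Bⁿ-ηₙ≡LₙQaᵈ)

open import Data.Nat using (ℕ)
import Data.Nat as ℕ
import Data.Nat.Coprimality as ℕC
open import Defs
open ExponentialCongruences

module FourSolutions (a b c r s : ℕ) (1<a : 1 ℕ.< a) (0<r : 0 ℕ.< r)
                     (ra⊥sb : ℕC.Coprime (r ℕ.* a) (s ℕ.* b)) where

  import Data.Nat.Properties as ℕP
  import Data.Nat.Divisibility as ℕD
  open import Data.Bool using (Bool; true; false)
  open import Data.Integer using (ℤ; +_; _+_; _*_; _-_; _^_; ∣_∣; 0ℤ; 1ℤ; -1ℤ; ≢-nonZero)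
  open import Data.Integer.Properties
  open import Data.Integer.Divisibility.Signed
    using ( _∣_; divides; ∣-refl; ∣-trans; ∣m∣n⇒∣m+n; ∣m∣n⇒∣m-n; ∣n⇒∣m*n; ∣m⇒∣m*n; ∣⇒∣ᵤ; ∣ᵤ⇒∣; 0∣⇒≡0
          ; *-monoʳ-∣; *-monoˡ-∣)
  open import Data.Integer.Tactic.RingSolver using (solve-∀)
  open import Data.Sum using (_⊎_; inj₁; inj₂)
  open import Data.Empty using (⊥-elim)
  open import Relation.Nullary using (¬_; yes; no)
  open import Relation.Binary.PropositionalEquality
  open import Function using (_∘_)

  A B R S : ℤ
  A = + a
  B = + b
  R = + r
  S = + s

  RA⊥SB : Coprime (R * A) (S * B)
  RA⊥SB = subst₂ Coprime (pos-* r a) (pos-* s b) (coprimeᵤ⇒coprime ra⊥sb)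

  sign : Bool → ℤ
  sign false = 1ℤ
  sign true  = -1ℤ

  sign-unit : ∀ σ → IsUnit (sign σ)
  sign-unit false = inj₁ refl
  sign-unit true  = inj₂ refl

  signed≡sign* : ∀ σ z → signed σ z ≡ sign σ * z
  signed≡sign* false z = sym (*-identityˡ z)
  signed≡sign* true  z = sym (-1*i≡-i z)

  δ ε : Sol → ℤ
  δ t = sign (u t)
  ε t = sign (v t)

  Solution : Sol → Set
  Solution = IsSolution a b c r s

  solution-equation : ∀ t → Solution t → δ t * (R * A ^ x t) + ε t * (S * B ^ y t) ≡ + c
  solution-equation t eq = trans (cong₂ _+_ (term (u t) r a (x t)) (term (v t) s b (y t))) eq
    where
    term : ∀ σ m n k → sign σ * (+ m * (+ n) ^ k) ≡ signed σ (+ (m ℕ.* n ℕ.^ k))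
    term σ m n k = trans (cong (λ z → sign σ * (+ m * z)) (pos-^ n k))
                         (trans (cong (sign σ *_) (sym (pos-* m (n ℕ.^ k)))) (sym (signed≡sign* σ _)))

  K : Sol → Sol → ℤ
  K t t′ = δ t′ * A ^ (x t′ ℕ.∸ x t) - δ t

  pair-identity : ∀ t t′ → Solution t → Solution t′ → x t ℕ.≤ x t′ →
    S * (ε t * B ^ y t - ε t′ * B ^ y t′) ≡ R * A ^ x t * K t t′
  pair-identity t t′ h h′ x≤x′ = begin
    S * (ε t * B ^ y t - ε t′ * B ^ y t′)
      ≡⟨ split R S (δ t) (δ t′) (ε t) (ε t′) (A ^ x t) (A ^ (x t′ ℕ.∸ x t)) (B ^ y t) (B ^ y t′) ⟩
    R * A ^ x t * K t t′ + (E - E′)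
      ≡⟨ cong (_+_ (R * A ^ x t * K t t′)) (i≡j⇒i-j≡0 (trans (solution-equation t h) (sym E′≡c))) ⟩
    R * A ^ x t * K t t′ + 0ℤ
      ≡⟨ +-identityʳ _ ⟩
    R * A ^ x t * K t t′ ∎
    where
    open ≡-Reasoning
    E E′ : ℤ
    E = δ t * (R * A ^ x t) + ε t * (S * B ^ y t)
    E′ = δ t′ * (R * (A ^ x t * A ^ (x t′ ℕ.∸ x t))) + ε t′ * (S * B ^ y t′)
    E′≡c : E′ ≡ + c
    E′≡c = subst (λ z → δ t′ * (R * z) + ε t′ * (S * B ^ y t′) ≡ + c) (^-split A x≤x′) (solution-equation t′ h′)
    split : ∀ R S δ δ′ ε ε′ Aˣ Aᵈ Bʸ Bʸ′ →
      S * (ε * Bʸ - ε′ * Bʸ′)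
        ≡ R * Aˣ * (δ′ * Aᵈ - δ) + ((δ * (R * Aˣ) + ε * (S * Bʸ)) - (δ′ * (R * (Aˣ * Aᵈ)) + ε′ * (S * Bʸ′)))
    split = solve-∀

  factors-coprime : ∀ {x y} → x ∣ R * A → y ∣ S * B → Coprime x y
  factors-coprime x∣RA y∣SB = coprime-∣ʳ y∣SB (coprime-∣ˡ x∣RA RA⊥SB)

  R∣RA : R ∣ R * A
  R∣RA = ∣m⇒∣m*n A ∣-refl
  A∣RA : A ∣ R * A
  A∣RA = ∣n⇒∣m*n R ∣-refl
  S∣SB : S ∣ S * B
  S∣SB = ∣m⇒∣m*n B ∣-refl
  B∣SB : B ∣ S * B
  B∣SB = ∣n⇒∣m*n S ∣-refl

  A⊥B : Coprime A B
  A⊥B = factors-coprime A∣RA B∣SB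

  RAᵏ⊥S : ∀ k → Coprime (R * A ^ k) S
  RAᵏ⊥S k = coprime-*ˡ (factors-coprime R∣RA S∣SB) (coprime-^ˡ (factors-coprime A∣RA S∣SB) k)

  RAᵏ⊥Bᵐ : ∀ k m → Coprime (R * A ^ k) (B ^ m)
  RAᵏ⊥Bᵐ k m = coprime-*ˡ (⊥Bᵐ (factors-coprime R∣RA B∣SB)) (coprime-^ˡ (⊥Bᵐ A⊥B) k)
    where
    ⊥Bᵐ : ∀ {z} → Coprime z B → Coprime z (B ^ m)
    ⊥Bᵐ z⊥B = coprime-sym (coprime-^ˡ (coprime-sym z⊥B) m)

  ∣RAᵏ∣≡raᵏ : ∀ k → ∣ R * A ^ k ∣ ≡ r ℕ.* a ℕ.^ k
  ∣RAᵏ∣≡raᵏ k = cong ∣_∣ (trans (cong (R *_) (pos-^ a k)) (sym (pos-* r (a ℕ.^ k))))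

  instance
    r≢0 : ℕ.NonZero r
    r≢0 = ℕ.>-nonZero 0<r
    a≢0 : ℕ.NonZero a
    a≢0 = ℕ.>-nonZero (ℕP.<-trans ℕ.z<s 1<a)

  RAᵏ≢0 : ∀ k → R * A ^ k ≢ 0ℤ
  RAᵏ≢0 k RAᵏ≡0 = ℕ.≢-nonZero⁻¹ _ {{ℕP.m*n≢0 r (a ℕ.^ k) {{r≢0}} {{ℕP.m^n≢0 a k}}}}
                                  (trans (sym (∣RAᵏ∣≡raᵏ k)) (cong ∣_∣ RAᵏ≡0))

  record Congruence (t t′ : Sol) : Set where
    field
      k : ℕ
      η L : ℤ
      η-unit : IsUnit η
      k≤y⊔y′ : k ℕ.≤ y t ℕ.⊔ y t′
      Bᵏ-η≡LQ : B ^ k - η ≡ L * (R * A ^ x t)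
      L∣K : L ∣ K t t′

  congruence : ∀ t t′ → Solution t → Solution t′ → x t ℕ.≤ x t′ → Congruence t t′
  congruence t t′ h h′ x≤x′ = record
    { k = k ; η = η ; L = L ; η-unit = η-unit ; k≤y⊔y′ = k≤bound ; Bᵏ-η≡LQ = Bᵏ-η≡LQ
    ; L∣K = divides (S * σ * B ^ m) K≡SσBᵐL }
    where
    open ≡-Reasoning
    open PowerDifference (power-difference B (y t) (y t′) (sign-unit (v t)) (sign-unit (v t′)))
    Q = R * A ^ x t
    instance _ = ≢-nonZero (RAᵏ≢0 (x t))
    SD≡QK = pair-identity t t′ h h′ x≤x′
    Q∣σBᵐ[Bᵏ-η] : Q ∣ B ^ m * (B ^ k - η) * σ
    Q∣σBᵐ[Bᵏ-η] = subst (Q ∣_) (trans D≡σBᵐ[Bᵏ-η] (*-comm σ _))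
                   (coprime-divisor (RAᵏ⊥S (x t)) (divides (K t t′) (trans SD≡QK (*-comm Q (K t t′)))))
    Q∣Bᵏ-η : Q ∣ B ^ k - η
    Q∣Bᵏ-η = coprime-divisor (RAᵏ⊥Bᵐ (x t) m) (∣*unit⇒∣ σ-unit Q∣σBᵐ[Bᵏ-η])
    open _∣_ Q∣Bᵏ-η renaming (quotient to L; equality to Bᵏ-η≡LQ)
    rearrange : ∀ Q S σ Bᵐ L → S * (σ * (Bᵐ * (L * Q))) ≡ Q * (S * σ * Bᵐ * L)
    rearrange = solve-∀
    K≡SσBᵐL : K t t′ ≡ S * σ * B ^ m * L
    K≡SσBᵐL = *-cancelˡ-≡ Q (K t t′) (S * σ * B ^ m * L) (begin
      Q * K t t′                               ≡⟨ sym SD≡QK ⟩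
      S * (ε t * B ^ y t - ε t′ * B ^ y t′)    ≡⟨ cong (S *_) D≡σBᵐ[Bᵏ-η] ⟩
      S * (σ * (B ^ m * (B ^ k - η)))          ≡⟨ cong (λ z → S * (σ * (B ^ m * z))) Bᵏ-η≡LQ ⟩
      S * (σ * (B ^ m * (L * Q)))              ≡⟨ rearrange Q S σ (B ^ m) L ⟩
      Q * (S * σ * B ^ m * L)                  ∎)

  S∣K : ∀ t t′ → Solution t → Solution t′ → x t ℕ.≤ x t′ → S ∣ K t t′
  S∣K t t′ h h′ x≤x′ = coprime-divisor (coprime-sym (RAᵏ⊥S (x t)))
    (divides (ε t * B ^ y t - ε t′ * B ^ y t′) (trans (sym (pair-identity t t′ h h′ x≤x′)) (*-comm S _)))

  K⊥A : ∀ t t′ → x t ℕ.< x t′ → Coprime (K t t′) A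
  K⊥A t t′ x<x′ = coprime-unit*aᵏ-unit (x t′ ℕ.∸ x t) (ℕP.m<n⇒0<n∸m x<x′) (sign-unit (u t′)) (sign-unit (u t))

  ∣K∣≤aᵈ+1 : ∀ t t′ → ∣ K t t′ ∣ ℕ.≤ a ℕ.^ (x t′ ℕ.∸ x t) ℕ.+ 1
  ∣K∣≤aᵈ+1 t t′ = ∣unit*aᵏ-unit∣≤ a (x t′ ℕ.∸ x t) (sign-unit (u t′)) (sign-unit (u t))

  -- k = 0 would force Bᵏ - η = 0, since a nonzero multiple of Q has absolute value at least 3; then L = 0 divides K.
  k≢0 : ∀ t t′ → 3 ℕ.≤ ∣ R * A ^ x t ∣ → x t ℕ.< x t′ → (C : Congruence t t′) → Congruence.k C ≢ 0
  k≢0 t t′ 3≤∣Q∣ x<x′ C k≡0 = ¬coprime-0 1<a (subst (λ z → Coprime z A) K≡0 (K⊥A t t′ x<x′))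
    where
    open Congruence C
    1≡η : 1ℤ ≡ η
    1≡η = unit≡unit-mod 3≤∣Q∣ (inj₁ refl) η-unit
      (divides L (subst (λ j → B ^ j - η ≡ L * (R * A ^ x t)) k≡0 Bᵏ-η≡LQ))
    LQ≡0 : L * (R * A ^ x t) ≡ 0ℤ
    LQ≡0 = trans (sym Bᵏ-η≡LQ) (cong₂ (λ j μ → B ^ j - μ) k≡0 (sym 1≡η))
    L≡0 : L ≡ 0ℤ
    L≡0 with i*j≡0⇒i≡0∨j≡0 L LQ≡0
    ... | inj₁ L≡0 = L≡0
    ... | inj₂ Q≡0 = ⊥-elim (RAᵏ≢0 (x t) Q≡0)
    K≡0 : K t t′ ≡ 0ℤ
    K≡0 = 0∣⇒≡0 (subst (_∣ K t t′) L≡0 L∣K)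

  2∣a⇒¬2∣b : 2 ℕD.∣ a → ¬ 2 ℕD.∣ b
  2∣a⇒¬2∣b 2∣a 2∣b with ℕD.∣1⇒≡1 (∣⇒∣ᵤ (A⊥B (∣ᵤ⇒∣ {+ 2} {A} 2∣a) (∣ᵤ⇒∣ {+ 2} {B} 2∣b)))
  ... | ()

  -- Reducing the first two equations mod 2: b is odd, so s (ε₁ b^y₁ − ε₂ b^y₂) is even, whereas r (δ₂ a − δ₁) ≡ r.
  x₂≡1⇒2∣r : ∀ t₁ t₂ → 2 ℕD.∣ a → Solution t₁ → Solution t₂ →
    x t₁ ℕ.< x t₂ → x t₂ ≡ 1 → 2 ℕD.∣ r
  x₂≡1⇒2∣r t₁ t₂ 2∣a h₁ h₂ x₁<x₂ x₂≡1 = ∣⇒∣ᵤ {+ 2} {R} (∣*unit⇒∣ (sign-unit (u t₁)) 2∣Rδ₁)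
    where
    x₁≡0 : x t₁ ≡ 0
    x₁≡0 = ℕP.n<1⇒n≡0 (subst (x t₁ ℕ.<_) x₂≡1 x₁<x₂)
    2∣Bʸ-1 : ∀ j → + 2 ∣ B ^ j - 1ℤ
    2∣Bʸ-1 j = ∣-trans (2∣odd-1 (2∣a⇒¬2∣b 2∣a))
                       (subst (λ z → B - 1ℤ ∣ B ^ j - z) (^-zeroˡ j) (x-y∣xᵏ-yᵏ B 1ℤ j))
    regroup : ∀ ε ε′ X X′ → ε * (X - 1ℤ) - ε′ * (X′ - 1ℤ) + (ε - ε′) ≡ ε * X - ε′ * X′
    regroup = solve-∀
    2∣D : + 2 ∣ ε t₁ * B ^ y t₁ - ε t₂ * B ^ y t₂
    2∣D = subst (+ 2 ∣_) (regroup (ε t₁) (ε t₂) (B ^ y t₁) (B ^ y t₂))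
      (∣m∣n⇒∣m+n (∣m∣n⇒∣m-n (∣n⇒∣m*n (ε t₁) (2∣Bʸ-1 (y t₁))) (∣n⇒∣m*n (ε t₂) (2∣Bʸ-1 (y t₂))))
                 (2∣unit-unit (sign-unit (v t₁)) (sign-unit (v t₂))))
    SD≡R[δ₂A-δ₁] : S * (ε t₁ * B ^ y t₁ - ε t₂ * B ^ y t₂) ≡ R * 1ℤ * (δ t₂ * (A * 1ℤ) - δ t₁)
    SD≡R[δ₂A-δ₁] =
      subst₂ (λ i j → S * (ε t₁ * B ^ y t₁ - ε t₂ * B ^ y t₂) ≡ R * A ^ i * (δ t₂ * A ^ (j ℕ.∸ i) - δ t₁))
             x₁≡0 x₂≡1 (pair-identity t₁ t₂ h₁ h₂ (ℕP.<⇒≤ x₁<x₂))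
    cancel : ∀ R δ δ′ A → R * δ′ * A - R * 1ℤ * (δ′ * (A * 1ℤ) - δ) ≡ R * δ
    cancel = solve-∀
    2∣Rδ₁ : + 2 ∣ R * δ t₁
    2∣Rδ₁ = subst (+ 2 ∣_) (cancel R (δ t₁) (δ t₂) A)
      (∣m∣n⇒∣m-n (∣n⇒∣m*n (R * δ t₂) (∣ᵤ⇒∣ {+ 2} {A} 2∣a))
                 (subst (+ 2 ∣_) SD≡R[δ₂A-δ₁] (∣n⇒∣m*n S 2∣D)))

  odd⊎2a∣RAˣ : ∀ t₁ t₂ → Solution t₁ → Solution t₂ → x t₁ ℕ.< x t₂ →
    ¬ 2 ℕD.∣ a ⊎ (+ 2 * A) ∣ R * A ^ x t₂
  odd⊎2a∣RAˣ t₁ t₂ h₁ h₂ x₁<x₂ with 2 ℕD.∣? a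
  ... | no ¬2∣a = inj₁ ¬2∣a
  ... | yes 2∣a with 2 ℕD.∣? r | x t₂ ℕP.≟ 1
  ...   | yes 2∣r | _        = inj₂ (∣-trans (*-monoˡ-∣ A (∣ᵤ⇒∣ {+ 2} {R} 2∣r))
                                  (*-monoʳ-∣ R (subst (_∣ A ^ x t₂) (^-identityʳ A) (xᵐ∣xⁿ A 1≤x₂))))
    where
    1≤x₂ : 1 ℕ.≤ x t₂
    1≤x₂ = ℕP.≤-<-trans ℕ.z≤n x₁<x₂
  ...   | no ¬2∣r | yes x₂≡1 = ⊥-elim (¬2∣r (x₂≡1⇒2∣r t₁ t₂ 2∣a h₁ h₂ x₁<x₂ x₂≡1))
  ...   | no _    | no x₂≢1  = inj₂ (∣-trans (*-monoˡ-∣ A (∣ᵤ⇒∣ {+ 2} {A} 2∣a))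
                                  (∣n⇒∣m*n R (subst (_∣ A ^ x t₂) (cong (A *_) (^-identityʳ A)) (xᵐ∣xⁿ A 2≤x₂))))
    where
    2≤x₂ : 2 ℕ.≤ x t₂
    2≤x₂ = ℕP.≤∧≢⇒< (ℕP.≤-<-trans ℕ.z≤n x₁<x₂) (x₂≢1 ∘ sym)

  A∣RAᵏ : ∀ k → 1 ℕ.≤ k → A ∣ R * A ^ k
  A∣RAᵏ k 1≤k = ∣n⇒∣m*n R (subst (_∣ A ^ k) (^-identityʳ A) (xᵐ∣xⁿ A 1≤k))

  ∣d∣≤∣RAᵏ∣ : ∀ k {d} → d ∣ R * A ^ k → ∣ d ∣ ℕ.≤ ∣ R * A ^ k ∣
  ∣d∣≤∣RAᵏ∣ k d∣RAᵏ = ℕD.∣⇒≤ {{ℕ.≢-nonZero (RAᵏ≢0 k ∘ ∣i∣≡0⇒i≡0)}} (∣⇒∣ᵤ d∣RAᵏ)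

  lifting-hypotheses : ∀ t₁ t₂ → Solution t₁ → Solution t₂ → x t₁ ℕ.< x t₂ → LiftingHypotheses a (R * A ^ x t₂)
  lifting-hypotheses t₁ t₂ h₁ h₂ x₁<x₂ with odd⊎2a∣RAˣ t₁ t₂ h₁ h₂ x₁<x₂
  ... | inj₁ a-odd = record
    { 3≤∣Q∣ = ℕP.≤-trans 3≤a (∣d∣≤∣RAᵏ∣ (x t₂) A∣Q)
    ; a∣Q = A∣Q
    ; a²∣[aC2]Q = a²∣[aC2]*Q-odd a a-odd A∣Q }
    where
    A∣Q = A∣RAᵏ (x t₂) (ℕP.≤-<-trans ℕ.z≤n x₁<x₂)
    3≤a : 3 ℕ.≤ a
    3≤a = ℕP.≤∧≢⇒< 1<a (λ 2≡a → a-odd (subst (2 ℕD.∣_) 2≡a ℕD.∣-refl))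
  ... | inj₂ 2a∣Q = record
    { 3≤∣Q∣ = ℕP.≤-trans 3≤2a (subst (ℕ._≤ ∣ R * A ^ x t₂ ∣) (abs-* (+ 2) A) (∣d∣≤∣RAᵏ∣ (x t₂) 2a∣Q))
    ; a∣Q = ∣-trans (∣n⇒∣m*n (+ 2) ∣-refl) 2a∣Q
    ; a²∣[aC2]Q = a²∣[aC2]*Q-even a 2a∣Q }
    where
    3≤2a : 3 ℕ.≤ 2 ℕ.* a
    3≤2a = ℕP.≤-trans (ℕ.s≤s (ℕ.s≤s (ℕ.s≤s ℕ.z≤n))) (ℕP.*-monoʳ-≤ 2 1<a)

  record ExponentBound (t₂ t₃ t₄ : Sol) : Set where
    field
      f N : ℕ
      0<f : 0 ℕ.< f
      aᵈ≤N : a ℕ.^ (x t₃ ℕ.∸ x t₂) ℕ.≤ N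
      N*f≤y₃⊔y₄ : N ℕ.* f ℕ.≤ y t₃ ℕ.⊔ y t₄
      raˣ≤bᶠ+1 : r ℕ.* a ℕ.^ x t₂ ℕ.≤ b ℕ.^ f ℕ.+ 1

  exponent-bound : ∀ t₁ t₂ t₃ t₄ → Solution t₁ → Solution t₂ → Solution t₃ → Solution t₄ →
    x t₁ ℕ.< x t₂ → x t₂ ℕ.< x t₃ → x t₃ ℕ.< x t₄ → ExponentBound t₂ t₃ t₄
  exponent-bound t₁ t₂ t₃ t₄ h₁ h₂ h₃ h₄ x₁<x₂ x₂<x₃ x₃<x₄ = record
    { f = f ; N = N
    ; 0<f = ℕP.n≢0⇒n>0 λ f≡0 → n≢0 (trans n≡N*f (trans (cong (N ℕ.*_) f≡0) (ℕP.*-zeroʳ N)))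
    ; aᵈ≤N = ℕD.∣⇒≤ {{ℕ.≢-nonZero N≢0}} (subst (ℕD._∣ N) (cong ∣_∣ (pos-^ a d)) (∣⇒∣ᵤ aᵈ∣N))
    ; N*f≤y₃⊔y₄ = subst (ℕ._≤ y t₃ ℕ.⊔ y t₄) n≡N*f C₃₄.k≤y⊔y′
    ; raˣ≤bᶠ+1 = subst (ℕ._≤ b ℕ.^ f ℕ.+ 1) (∣RAᵏ∣≡raᵏ (x t₂)) (∣Q∣≤bᶠ+1 b f L≢0 η-unit Bᶠ-η≡LQ)
    }
    where
    d = x t₃ ℕ.∸ x t₂
    Q = R * A ^ x t₂
    hyp = lifting-hypotheses t₁ t₂ h₁ h₂ x₁<x₂
    module C₂₃ = Congruence (congruence t₂ t₃ h₂ h₃ (ℕP.<⇒≤ x₂<x₃))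
    C₃₄ = congruence t₃ t₄ h₃ h₄ (ℕP.<⇒≤ x₃<x₄)
    module C₃₄ = Congruence C₃₄
    RAˣ³≡QAᵈ : R * A ^ x t₃ ≡ Q * A ^ d
    RAˣ³≡QAᵈ = trans (cong (R *_) (^-split A (ℕP.<⇒≤ x₂<x₃))) (sym (*-assoc R (A ^ x t₂) (A ^ d)))
    3≤∣RAˣ³∣ : 3 ℕ.≤ ∣ R * A ^ x t₃ ∣
    3≤∣RAˣ³∣ = ℕP.≤-trans (LiftingHypotheses.3≤∣Q∣ hyp)
                          (∣d∣≤∣RAᵏ∣ (x t₃) (subst (Q ∣_) (sym RAˣ³≡QAᵈ) (∣m⇒∣m*n (A ^ d) ∣-refl)))
    open GcdLift (gcd-lift a d {B = B} {e = C₂₃.k} {n = C₃₄.k} {Lₑ = C₂₃.L} {Lₙ = C₃₄.L} hyp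
      C₂₃.η-unit C₂₃.Bᵏ-η≡LQ (coprime-∣ˡ C₂₃.L∣K (K⊥A t₂ t₃ x₂<x₃))
      C₃₄.η-unit (subst (λ M → B ^ C₃₄.k - C₃₄.η ≡ C₃₄.L * M) RAˣ³≡QAᵈ C₃₄.Bᵏ-η≡LQ))
    n≢0 : C₃₄.k ≢ 0
    n≢0 = k≢0 t₃ t₄ 3≤∣RAˣ³∣ x₃<x₄ C₃₄
    N≢0 : N ≢ 0
    N≢0 N≡0 = n≢0 (trans n≡N*f (cong (ℕ._* f) N≡0))
    L≢0 : L ≢ 0ℤ
    L≢0 L≡0 = ¬coprime-0 1<a (subst (λ z → Coprime z A) L≡0 L⊥a)

  s≤aᵈ+1 : ∀ t t′ → Solution t → Solution t′ → x t ℕ.< x t′ → s ℕ.≤ a ℕ.^ (x t′ ℕ.∸ x t) ℕ.+ 1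
  s≤aᵈ+1 t t′ h h′ x<x′ =
    ℕP.≤-trans (ℕD.∣⇒≤ {{K≢0}} (∣⇒∣ᵤ {S} {K t t′} (S∣K t t′ h h′ (ℕP.<⇒≤ x<x′)))) (∣K∣≤aᵈ+1 t t′)
    where
    K≢0 : ℕ.NonZero ∣ K t t′ ∣
    K≢0 = ℕ.≢-nonZero λ ∣K∣≡0 →
      ¬coprime-0 1<a (subst (λ z → Coprime z A) (∣i∣≡0⇒i≡0 ∣K∣≡0) (K⊥A t t′ x<x′))

open import Data.Nat using (_+_; _*_; _^_; _∸_; _≤_; _<_; _>_; _⊔_; suc)
import Data.Nat.Properties as ℕP
open import Data.Nat.GCD using (gcd)
open import Data.Product using (_×_; _,_)
open import Relation.Binary.PropositionalEquality using (_≡_; cong; sym)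

aˣ≤bᶠ+1⇒x≤f : ∀ {a b x f} → b < a → 1 < b → a ^ x ≤ b ^ f + 1 → x ≤ f
aˣ≤bᶠ+1⇒x≤f {a} {b} {x} {f} b<a 1<b aˣ≤bᶠ+1 = ℕP.≮⇒≥ λ f<x → ℕP.<⇒≱ (bᶠ+1<aˣ f<x) aˣ≤bᶠ+1
  where
  instance
    b≢0 : ℕ.NonZero b
    b≢0 = ℕ.>-nonZero (ℕP.<-trans ℕ.z<s 1<b)
    a≢0 : ℕ.NonZero a
    a≢0 = ℕ.>-nonZero (ℕP.<-trans (ℕP.<-trans ℕ.z<s 1<b) b<a)
  open ℕP.≤-Reasoning
  bᶠ+1<aˣ : f < x → b ^ f + 1 < a ^ x
  bᶠ+1<aˣ f<x = begin-strict
    b ^ f + 1      ≤⟨ ℕP.+-monoʳ-≤ (b ^ f) (ℕP.m^n>0 b f) ⟩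
    b ^ f + b ^ f  ≡⟨ cong (b ^ f +_) (sym (ℕP.+-identityʳ (b ^ f))) ⟩
    2 * b ^ f      <⟨ ℕP.*-monoˡ-< (b ^ f) {{ℕP.m^n≢0 b f}} (ℕP.≤-<-trans 1<b b<a) ⟩
    a * b ^ f      ≤⟨ ℕP.*-monoʳ-≤ a (ℕP.^-monoˡ-≤ f (ℕP.<⇒≤ b<a)) ⟩
    a ^ suc f      ≤⟨ ℕP.^-monoʳ-≤ a f<x ⟩
    a ^ x          ∎

lemma13 : (a b c r s : ℕ) → 1 < a → 1 < b → 0 < c → 0 < r → 0 < s →
          gcd (r * a) (s * b) ≡ 1 →
          (t₁ t₂ t₃ t₄ : Sol) →
          IsSolution a b c r s t₁ → IsSolution a b c r s t₂ →
          IsSolution a b c r s t₃ → IsSolution a b c r s t₄ →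
          x t₁ < x t₂ → x t₂ < x t₃ → x t₃ < x t₄ →
          let Z = x t₄ ⊔ y t₁ ⊔ y t₂ ⊔ y t₃ ⊔ y t₄ in
          (a ^ (x t₃ ∸ x t₂) ≤ Z) × (s ≤ suc Z) ×
          (a > b → x t₂ * a ^ (x t₃ ∸ x t₂) ≤ Z)
lemma13 a b c r s 1<a 1<b _ 0<r _ gcd≡1 t₁ t₂ t₃ t₄ h₁ h₂ h₃ h₄ x₁<x₂ x₂<x₃ x₃<x₄ =
  aᵈ≤Z , s≤1+Z , x₂aᵈ≤Z
  where
  open FourSolutions a b c r s 1<a 0<r (ℕC.gcd≡1⇒coprime gcd≡1)
  Z = x t₄ ⊔ y t₁ ⊔ y t₂ ⊔ y t₃ ⊔ y t₄
  open ExponentBound (exponent-bound t₁ t₂ t₃ t₄ h₁ h₂ h₃ h₄ x₁<x₂ x₂<x₃ x₃<x₄)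
  instance
    f≢0 : ℕ.NonZero f
    f≢0 = ℕ.>-nonZero 0<f
  N*f≤Z : N * f ≤ Z
  N*f≤Z = ℕP.≤-trans N*f≤y₃⊔y₄
    (ℕP.⊔-lub (ℕP.≤-trans (ℕP.m≤n⊔m (x t₄ ⊔ y t₁ ⊔ y t₂) (y t₃)) (ℕP.m≤m⊔n _ (y t₄))) (ℕP.m≤n⊔m _ (y t₄)))
  aᵈ≤Z : a ^ (x t₃ ∸ x t₂) ≤ Z
  aᵈ≤Z = ℕP.≤-trans aᵈ≤N (ℕP.≤-trans (ℕP.m≤m*n N f) N*f≤Z)
  s≤1+Z : s ≤ suc Z
  s≤1+Z = ℕP.≤-trans (s≤aᵈ+1 t₂ t₃ h₂ h₃ x₂<x₃)
                     (ℕP.≤-trans (ℕP.+-monoˡ-≤ 1 aᵈ≤Z) (ℕP.≤-reflexive (ℕP.+-comm Z 1)))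
  x₂aᵈ≤Z : a > b → x t₂ * a ^ (x t₃ ∸ x t₂) ≤ Z
  x₂aᵈ≤Z b<a = ℕP.≤-trans (ℕP.*-mono-≤ x₂≤f aᵈ≤N) (ℕP.≤-trans (ℕP.≤-reflexive (ℕP.*-comm f N)) N*f≤Z)
    where
    x₂≤f : x t₂ ≤ f
    x₂≤f = aˣ≤bᶠ+1⇒x≤f b<a 1<b (ℕP.≤-trans (ℕP.m≤n*m (a ^ x t₂) r {{ℕ.>-nonZero 0<r}}) raˣ≤bᶠ+1)
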